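{- For every positive integer $n$ and every real matrix $A=(a_{ij})\in\mathrm{TSSCPP}(n)$, the following inequalities hold: $$\sum_{j'=1}^{j}a_{i+1,j'}+\sum_{i'=1}^{i+1}a_{i',j+1}\ge1\quad\text{for all }1\le i\le n-2,\ 1\le j\le n-2,\ i+j\ge n-1;$$ $$\sum_{j'=1}^{j+1}a_{2,j'}+\sum_{j'=j+1}^{n}a_{1,j'}\ge1\quad\text{for all }1\le j\le n-3;$$ $$\sum_{i'=1}^{i+1}a_{i',2}+\sum_{i'=i+1}^{n}a_{i',1}\ge1\quad\text{for all }1\le i\le n-3.$$
   Context: An $n\times n$ magog matrix is an $n\times n$ matrix $A=(a_{ij})$ with entries in $\{0,1,-1\}$ such that all row sums and all column sums equal $1$, $0\le \sum_{i'=1}^{i}a_{i'j}\le 1$ for all $1\le i,j\le n$, $\sum_{j'=1}^{j}a_{ij'}\ge 0$ for all $1\le i,j\le n$, and for all $1\le i\le n-2$, $1\le j\le n-2$, $$\sum_{j'=1}^{j}a_{i+1,j'}+\sum_{i'=1}^{i+1}a_{i',j+1}-\sum_{i'=1}^{i}a_{i'j}\ge 0.$$ $\mathrm{TSSCPP}(n)\subseteq\mathbb{R}^{n\times n}$ is the convex hull of all $n\times n$ magog matrices.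
   Formalization: The matrix A has entries in ℚ rather than ℝ, and the weights expressing it as a convex combination of magog matrices are rational. -}

module Defs where

open import Data.Nat as ℕ using (ℕ; zero; suc; _<?_)
open import Data.Fin using (Fin; fromℕ<)
open import Data.Integer as ℤ using (ℤ)
open import Data.Rational as ℚ using (ℚ; 0ℚ; 1ℚ)
open import Data.List using (List; []; _∷_; map; upTo; foldr)
open import Data.Product using (_×_; _,_; ∃)
open import Data.Sum using (_⊎_)
open import Relation.Nullary using (yes; no)
open import Relation.Binary.PropositionalEquality using (_≡_)

Mat : ℕ → Set → Set
Mat n A = Fin n → Fin n → A

-- 1-based entry access: entry M i j = a_{ij} for 1 ≤ i,j ≤ n, and z outside
entry : ∀ {A : Set} {n} → A → Mat n A → ℕ → ℕ → A
entry {n = n} z M (suc i) (suc j) with i <? n | j <? n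
... | yes p | yes q = M (fromℕ< p) (fromℕ< q)
... | yes _ | no _  = z
... | no _  | _     = z
entry z M _ _ = z

-- the list [a, a+1, ..., b] (empty if b < a)
range : ℕ → ℕ → List ℕ
range a b = map (a ℕ.+_) (upTo (suc b ℕ.∸ a))

Σℤ : ℕ → ℕ → (ℕ → ℤ) → ℤ
Σℤ a b f = foldr (λ k s → f k ℤ.+ s) (ℤ.+ 0) (range a b)

Σℚ : ℕ → ℕ → (ℕ → ℚ) → ℚ
Σℚ a b f = foldr (λ k s → f k ℚ.+ s) 0ℚ (range a b)

record IsMagog (n : ℕ) (M : Mat n ℤ) : Set where
  private a = entry (ℤ.+ 0) M
  field
    entries   : ∀ i j → M i j ≡ ℤ.+ 0 ⊎ M i j ≡ ℤ.+ 1 ⊎ M i j ≡ ℤ.- ℤ.+ 1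
    rowSum    : ∀ i → 1 ℕ.≤ i → i ℕ.≤ n → Σℤ 1 n (λ j' → a i j') ≡ ℤ.+ 1
    colSum    : ∀ j → 1 ℕ.≤ j → j ℕ.≤ n → Σℤ 1 n (λ i' → a i' j) ≡ ℤ.+ 1
    colPartLo : ∀ i j → 1 ℕ.≤ i → i ℕ.≤ n → 1 ℕ.≤ j → j ℕ.≤ n →
                ℤ.+ 0 ℤ.≤ Σℤ 1 i (λ i' → a i' j)
    colPartHi : ∀ i j → 1 ℕ.≤ i → i ℕ.≤ n → 1 ℕ.≤ j → j ℕ.≤ n →
                Σℤ 1 i (λ i' → a i' j) ℤ.≤ ℤ.+ 1
    rowPart   : ∀ i j → 1 ℕ.≤ i → i ℕ.≤ n → 1 ℕ.≤ j → j ℕ.≤ n →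
                ℤ.+ 0 ℤ.≤ Σℤ 1 j (λ j' → a i j')
    extra     : ∀ i j → 1 ℕ.≤ i → i ℕ.≤ n ℕ.∸ 2 → 1 ℕ.≤ j → j ℕ.≤ n ℕ.∸ 2 →
                ℤ.+ 0 ℤ.≤ (Σℤ 1 j (λ j' → a (suc i) j')
                           ℤ.+ Σℤ 1 (suc i) (λ i' → a i' (suc j)))
                          ℤ.- Σℤ 1 i (λ i' → a i' j)

toℚ : ℤ → ℚ
toℚ z = z ℚ./ 1

-- A ∈ TSSCPP(n): A is a convex combination (finitely many nonnegative
-- weights summing to 1) of magog matrices.
sumWeights : ∀ {n} → List (ℚ × Mat n ℤ) → ℚ
sumWeights = foldr (λ { (l , _) s → l ℚ.+ s }) 0ℚ

combine : ∀ {n} → List (ℚ × Mat n ℤ) → Mat n ℚ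
combine [] i j = 0ℚ
combine ((l , M) ∷ ps) i j = l ℚ.* toℚ (M i j) ℚ.+ combine ps i j

data AllMagogPos (n : ℕ) : List (ℚ × Mat n ℤ) → Set where
  []  : AllMagogPos n []
  _∷_ : ∀ {l M ps} → (0ℚ ℚ.≤ l × IsMagog n M) → AllMagogPos n ps →
        AllMagogPos n ((l , M) ∷ ps)

InTSSCPP : (n : ℕ) → Mat n ℚ → Set
InTSSCPP n A = ∃ λ (ps : List (ℚ × Mat n ℤ)) →
  AllMagogPos n ps × sumWeights ps ≡ 1ℚ × (∀ i j → A i j ≡ combine ps i j)

{-# OPTIONS --safe #-}
module Submission where

-- Each inequality reads 1 ≤ φ(A) with φ the sum of the entries along two row or column
-- segments, so by linearity it suffices to prove it for magog matrices, where it is an integer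
-- inequality.  Write R i k and C i k for the row and column prefix sums.
-- Second and third families: since row 1 and column 1 sum to 1 they reduce to
-- R 1 j ≤ R 2 (j+1) and C i 1 ≤ C (i+1) 2.  The left-hand prefixes are 0 or 1, and once such a
-- prefix equals 1 the magog condition at (1, k) (inductively in k), resp. at (i, 1), forces the
-- right-hand side to be at least 1.
-- First family: put S k = R (i+1) k + C (i+1) (k+1).  The magog condition at (i, k+1) gives
-- S k ≤ 2 S (k+1), so if S j ≤ 0 then S k ≤ 0, hence C (i+1) (k+1) ≤ 0, for all k ≤ j.  But the
-- first i+1 rows have total sum i+1 and every column prefix is at most 1, so i+1 ≤ n-j-1,
-- contradicting i+j ≥ n-1.

open import Defs
open import Data.Nat.Base using (ℕ)
open import Data.Integer.Base using (ℤ)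

module Arithmetic where
  open import Data.Nat.Base as ℕ using (ℕ; zero; suc; _∸_; z≤n; s≤s)
  import Data.Nat.Properties as ℕ
  open import Data.Integer.Base using (ℤ; +_; -_; 0ℤ; _+_; _≤_; +≤+)
  import Data.Integer.Properties as ℤ
  open import Data.Sum.Base using (_⊎_; inj₁; inj₂)
  open import Relation.Binary.PropositionalEquality using (_≡_; refl; subst)
  open import Algebra.Properties.AbelianGroup ℤ.+-0-abelianGroup using (\\-leftDividesʳ)
  open ℤ.≤-Reasoning

  m≤n∸k⇒k+m≤n : ∀ {m} n k → 1 ℕ.≤ m → m ℕ.≤ n ∸ k → k ℕ.+ m ℕ.≤ n
  m≤n∸k⇒k+m≤n n       zero    _         m≤n   = m≤n
  m≤n∸k⇒k+m≤n zero    (suc k) (s≤s z≤n) ()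
  m≤n∸k⇒k+m≤n (suc n) (suc k) 1≤m       m≤n∸k = s≤s (m≤n∸k⇒k+m≤n n k 1≤m m≤n∸k)

  t<1+b∸a⇒a+t≤b : ∀ a {t b} → t ℕ.< suc b ∸ a → a ℕ.+ t ℕ.≤ b
  t<1+b∸a⇒a+t≤b a {t} {b} t<1+b∸a =
    ℕ.s≤s⁻¹ (subst (ℕ._≤ suc b) (ℕ.+-suc a t) (m≤n∸k⇒k+m≤n (suc b) a (s≤s z≤n) t<1+b∸a))

  0≤x≤1⇒x≡0∨x≡1 : ∀ {x} → 0ℤ ≤ x → x ≤ + 1 → x ≡ 0ℤ ⊎ x ≡ + 1
  0≤x≤1⇒x≡0∨x≡1 {+ 0}           _ _ = inj₁ refl
  0≤x≤1⇒x≡0∨x≡1 {+ 1}           _ _ = inj₂ refl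
  0≤x≤1⇒x≡0∨x≡1 {+ suc (suc _)} _ (+≤+ (s≤s ()))

  bit-≤ : ∀ {p q} → 0ℤ ≤ p → p ≤ + 1 → 0ℤ ≤ q → (p ≡ + 1 → + 1 ≤ q) → p ≤ q
  bit-≤ 0≤p p≤1 0≤q p≡1⇒1≤q with 0≤x≤1⇒x≡0∨x≡1 0≤p p≤1
  ... | inj₁ refl = 0≤q
  ... | inj₂ refl = p≡1⇒1≤q refl

  x+y≤x⇒y≤0 : ∀ x {y} → x + y ≤ x → y ≤ 0ℤ
  x+y≤x⇒y≤0 x {y} x+y≤x = begin
    y              ≡⟨ \\-leftDividesʳ x y ⟨
    - x + (x + y)  ≤⟨ ℤ.+-monoʳ-≤ (- x) x+y≤x ⟩
    - x + x        ≡⟨ ℤ.+-inverseˡ x ⟩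
    0ℤ             ∎

  p+t≡1⇒p≤q⇒1≤q+t : ∀ {p q t} → p + t ≡ + 1 → p ≤ q → + 1 ≤ q + t
  p+t≡1⇒p≤q⇒1≤q+t {p} {q} {t} p+t≡1 p≤q = begin
    + 1    ≡⟨ p+t≡1 ⟨
    p + t  ≤⟨ ℤ.+-monoˡ-≤ t p≤q ⟩
    q + t  ∎

module IntegerSums where
  open import Function.Base using (_∘_)
  open import Data.Nat.Base as ℕ using (ℕ; zero; suc; _∸_; z≤n; s≤s)
  import Data.Nat.Properties as ℕ
  open import Data.Integer.Base using (ℤ; +_; 0ℤ; _+_; _≤_)
  import Data.Integer.Properties as ℤ
  open import Data.List.Base using (foldr; map; applyUpTo)
  open import Relation.Binary.PropositionalEquality
  open import Algebra.Properties.CommutativeSemigroup ℤ.+-commutativeSemigroup using (interchange)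
  open ℤ.≤-Reasoning
  open Arithmetic using (t<1+b∸a⇒a+t≤b)

  Σ< : ℕ → (ℕ → ℤ) → ℤ
  Σ< zero    f = 0ℤ
  Σ< (suc m) f = f 0 + Σ< m (f ∘ suc)

  Σ<-snoc : ∀ m f → Σ< (suc m) f ≡ Σ< m f + f m
  Σ<-snoc zero    f = ℤ.+-comm (f 0) 0ℤ
  Σ<-snoc (suc m) f = trans (cong (_+_ (f 0)) (Σ<-snoc m (f ∘ suc))) (sym (ℤ.+-assoc (f 0) _ _))

  Σ<-split : ∀ m p f → Σ< (m ℕ.+ p) f ≡ Σ< m f + Σ< p (λ t → f (m ℕ.+ t))
  Σ<-split zero    p f = sym (ℤ.+-identityˡ _)
  Σ<-split (suc m) p f = trans (cong (_+_ (f 0)) (Σ<-split m p (f ∘ suc))) (sym (ℤ.+-assoc (f 0) _ _))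

  Σ<-mono : ∀ m {f g} → (∀ t → t ℕ.< m → f t ≤ g t) → Σ< m f ≤ Σ< m g
  Σ<-mono zero    _   = ℤ.≤-refl
  Σ<-mono (suc m) f≤g = ℤ.+-mono-≤ (f≤g 0 (s≤s z≤n)) (Σ<-mono m (λ t t<m → f≤g (suc t) (s≤s t<m)))

  Σ<-cong : ∀ m {f g} → (∀ t → t ℕ.< m → f t ≡ g t) → Σ< m f ≡ Σ< m g
  Σ<-cong zero    _   = refl
  Σ<-cong (suc m) f≡g = cong₂ _+_ (f≡g 0 (s≤s z≤n)) (Σ<-cong m (λ t t<m → f≡g (suc t) (s≤s t<m)))

  Σ<-zeros : ∀ m → Σ< m (λ _ → 0ℤ) ≡ 0ℤ
  Σ<-zeros zero    = refl
  Σ<-zeros (suc m) = trans (ℤ.+-identityˡ _) (Σ<-zeros m)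

  Σ<-ones : ∀ m → Σ< m (λ _ → + 1) ≡ + m
  Σ<-ones zero    = refl
  Σ<-ones (suc m) = cong (_+_ (+ 1)) (Σ<-ones m)

  Σ<-+ : ∀ m f g → Σ< m (λ t → f t + g t) ≡ Σ< m f + Σ< m g
  Σ<-+ zero    f g = refl
  Σ<-+ (suc m) f g =
    trans (cong (_+_ (f 0 + g 0)) (Σ<-+ m (f ∘ suc) (g ∘ suc))) (interchange (f 0) (g 0) _ _)

  Σ<-swap : ∀ m p (F : ℕ → ℕ → ℤ) → Σ< m (λ s → Σ< p (λ t → F t s)) ≡ Σ< p (λ t → Σ< m (λ s → F t s))
  Σ<-swap zero    p F = sym (Σ<-zeros p)
  Σ<-swap (suc m) p F =
    trans (cong (_+_ (Σ< p (λ t → F t 0))) (Σ<-swap m p (λ t s → F t (suc s))))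
          (sym (Σ<-+ p (λ t → F t 0) _))

  Σℤ≡Σ< : ∀ a b f → Σℤ a b f ≡ Σ< (suc b ∸ a) (λ t → f (a ℕ.+ t))
  Σℤ≡Σ< a b f = foldr-applyUpTo (suc b ∸ a) (λ t → t)
    where
    foldr-applyUpTo : ∀ m g → foldr (λ k s → f k + s) 0ℤ (map (a ℕ.+_) (applyUpTo g m))
                              ≡ Σ< m (λ t → f (a ℕ.+ g t))
    foldr-applyUpTo zero    g = refl
    foldr-applyUpTo (suc m) g = cong (_+_ (f (a ℕ.+ g 0))) (foldr-applyUpTo m (g ∘ suc))

  Σℤ-single : ∀ f → Σℤ 1 1 f ≡ f 1
  Σℤ-single f = ℤ.+-identityʳ (f 1)

  Σℤ-snoc : ∀ k f → Σℤ 1 (suc k) f ≡ Σℤ 1 k f + f (suc k)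
  Σℤ-snoc k f rewrite Σℤ≡Σ< 1 (suc k) f | Σℤ≡Σ< 1 k f = Σ<-snoc k (f ∘ suc)

  Σℤ-split : ∀ {k b} f → k ℕ.≤ b → Σℤ 1 b f ≡ Σℤ 1 k f + Σℤ (suc k) b f
  Σℤ-split {k} {b} f k≤b rewrite Σℤ≡Σ< 1 b f | Σℤ≡Σ< 1 k f | Σℤ≡Σ< (suc k) b f =
    trans (cong (λ m → Σ< m (f ∘ suc)) (sym (ℕ.m+[n∸m]≡n k≤b))) (Σ<-split k (b ∸ k) (f ∘ suc))

  Σℤ-mono : ∀ a b {f g} → (∀ t → a ℕ.≤ t → t ℕ.≤ b → f t ≤ g t) → Σℤ a b f ≤ Σℤ a b g
  Σℤ-mono a b {f} {g} f≤g rewrite Σℤ≡Σ< a b f | Σℤ≡Σ< a b g =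
    Σ<-mono (suc b ∸ a) (λ t t<m → f≤g (a ℕ.+ t) (ℕ.m≤m+n a t) (t<1+b∸a⇒a+t≤b a t<m))

  Σℤ-cong : ∀ a b {f g} → (∀ t → a ℕ.≤ t → t ℕ.≤ b → f t ≡ g t) → Σℤ a b f ≡ Σℤ a b g
  Σℤ-cong a b {f} {g} f≡g rewrite Σℤ≡Σ< a b f | Σℤ≡Σ< a b g =
    Σ<-cong (suc b ∸ a) (λ t t<m → f≡g (a ℕ.+ t) (ℕ.m≤m+n a t) (t<1+b∸a⇒a+t≤b a t<m))

  Σℤ-zeros : ∀ a b → Σℤ a b (λ _ → 0ℤ) ≡ 0ℤ
  Σℤ-zeros a b = trans (Σℤ≡Σ< a b (λ _ → 0ℤ)) (Σ<-zeros (suc b ∸ a))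

  Σℤ-ones : ∀ a b → Σℤ a b (λ _ → + 1) ≡ + (suc b ∸ a)
  Σℤ-ones a b = trans (Σℤ≡Σ< a b (λ _ → + 1)) (Σ<-ones (suc b ∸ a))

  Σℤ-swap : ∀ a b c d (F : ℕ → ℕ → ℤ) →
    Σℤ a b (λ s → Σℤ c d (λ t → F t s)) ≡ Σℤ c d (λ t → Σℤ a b (λ s → F t s))
  Σℤ-swap a b c d F = begin-equality
    Σℤ a b (λ s → Σℤ c d (λ t → F t s))
      ≡⟨ Σℤ≡Σ< a b (λ s → Σℤ c d (λ t → F t s)) ⟩
    Σ< m (λ s → Σℤ c d (λ t → F t (a ℕ.+ s)))
      ≡⟨ Σ<-cong m (λ s _ → Σℤ≡Σ< c d (λ t → F t (a ℕ.+ s))) ⟩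
    Σ< m (λ s → Σ< p (λ t → F (c ℕ.+ t) (a ℕ.+ s)))
      ≡⟨ Σ<-swap m p (λ t s → F (c ℕ.+ t) (a ℕ.+ s)) ⟩
    Σ< p (λ t → Σ< m (λ s → F (c ℕ.+ t) (a ℕ.+ s)))
      ≡⟨ Σ<-cong p (λ t _ → Σℤ≡Σ< a b (F (c ℕ.+ t))) ⟨
    Σ< p (λ t → Σℤ a b (λ s → F (c ℕ.+ t) s))
      ≡⟨ Σℤ≡Σ< c d (λ t → Σℤ a b (F t)) ⟨
    Σℤ c d (λ t → Σℤ a b (λ s → F t s))
      ∎
    where
    m = suc b ∸ a
    p = suc d ∸ c

module MagogInequalities {n : ℕ} {M : Mat n ℤ} (magog : IsMagog n M) where
  open import Data.Nat.Base as ℕ using (ℕ; zero; suc; _∸_; z≤n; s≤s)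
  import Data.Nat.Properties as ℕ
  open import Data.Integer.Base using (ℤ; +_; 0ℤ; _+_; _≤_; +≤+; nonNegative)
  import Data.Integer.Properties as ℤ
  open import Data.Sum.Base using (_⊎_; inj₁; inj₂)
  open import Relation.Binary.PropositionalEquality
  open import Relation.Nullary using (yes; no; contradiction)
  open import Algebra.Properties.CommutativeSemigroup ℤ.+-commutativeSemigroup using (x∙yz≈xz∙y)
  open ℤ.≤-Reasoning
  open Arithmetic
  open IntegerSums
  open IsMagog magog

  a : ℕ → ℕ → ℤ
  a = entry 0ℤ M

  R C : ℕ → ℕ → ℤ
  R i k = Σℤ 1 k (a i)
  C i k = Σℤ 1 i (λ i′ → a i′ k)

  R-nonneg : ∀ {i} k → 1 ℕ.≤ i → i ℕ.≤ n → k ℕ.≤ n → 0ℤ ≤ R i k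
  R-nonneg zero    _   _   _     = ℤ.≤-refl
  R-nonneg (suc k) 1≤i i≤n 1+k≤n = rowPart _ (suc k) 1≤i i≤n (s≤s z≤n) 1+k≤n

  R-snoc : ∀ i k → R i (suc k) ≡ R i k + a i (suc k)
  R-snoc i k = Σℤ-snoc k (a i)

  C-snoc : ∀ i k → C (suc i) k ≡ C i k + a (suc i) k
  C-snoc i k = Σℤ-snoc i (λ i′ → a i′ k)

  extra-≤ : ∀ {i k} → 1 ℕ.≤ i → i ℕ.≤ n ∸ 2 → 1 ℕ.≤ k → k ℕ.≤ n ∸ 2 →
            C i k ≤ R (suc i) k + C (suc i) (suc k)
  extra-≤ {i} {k} 1≤i i≤n∸2 1≤k k≤n∸2 = ℤ.0≤i-j⇒j≤i (extra i k 1≤i i≤n∸2 1≤k k≤n∸2)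

  rows-total : ∀ {r} → r ℕ.≤ n → Σℤ 1 n (C r) ≡ + r
  rows-total {r} r≤n = begin-equality
    Σℤ 1 n (λ k → Σℤ 1 r (λ i′ → a i′ k))  ≡⟨ Σℤ-swap 1 n 1 r a ⟩
    Σℤ 1 r (λ i′ → R i′ n)                  ≡⟨ Σℤ-cong 1 r (λ i′ 1≤i′ i′≤r → rowSum i′ 1≤i′ (ℕ.≤-trans i′≤r r≤n)) ⟩
    Σℤ 1 r (λ _ → + 1)                      ≡⟨ Σℤ-ones 1 r ⟩
    + r                                     ∎

  C₁≡1⇒1≤C₂ : ∀ {i} → 1 ℕ.≤ i → i ℕ.≤ n ∸ 2 → C i 1 ≡ + 1 → + 1 ≤ C (suc i) 2
  C₁≡1⇒1≤C₂ {i} 1≤i i≤n∸2 C≡1 = begin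
    + 1                                ≡⟨ C≡1 ⟨
    C i 1                              ≤⟨ extra-≤ 1≤i i≤n∸2 ℕ.≤-refl 1≤n∸2 ⟩
    R (suc i) 1 + C (suc i) 2          ≡⟨ cong (_+ C (suc i) 2) (Σℤ-single (a (suc i))) ⟩
    a (suc i) 1 + C (suc i) 2          ≤⟨ ℤ.+-monoˡ-≤ (C (suc i) 2) a≤0 ⟩
    0ℤ + C (suc i) 2                   ≡⟨ ℤ.+-identityˡ (C (suc i) 2) ⟩
    C (suc i) 2                        ∎
    where
    1≤n∸2 = ℕ.≤-trans 1≤i i≤n∸2
    1+i≤n = ℕ.<⇒≤ (m≤n∸k⇒k+m≤n n 2 1≤i i≤n∸2)
    a≤0 : a (suc i) 1 ≤ 0ℤ
    a≤0 = x+y≤x⇒y≤0 (C i 1) (begin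
      C i 1 + a (suc i) 1  ≡⟨ C-snoc i 1 ⟨
      C (suc i) 1          ≤⟨ colPartHi (suc i) 1 (s≤s z≤n) 1+i≤n ℕ.≤-refl (ℕ.≤-trans (s≤s z≤n) 1+i≤n) ⟩
      + 1                  ≡⟨ C≡1 ⟨
      C i 1                ∎)

  column-inequality : ∀ i → 1 ℕ.≤ i → i ℕ.≤ n ∸ 3 →
                      + 1 ≤ C (suc i) 2 + Σℤ (suc i) n (λ i′ → a i′ 1)
  column-inequality i 1≤i i≤n∸3 =
    p+t≡1⇒p≤q⇒1≤q+t (trans (sym (Σℤ-split (λ i′ → a i′ 1) i≤n)) (colSum 1 ℕ.≤-refl 1≤n))
      (bit-≤ (colPartLo i 1 1≤i i≤n ℕ.≤-refl 1≤n) (colPartHi i 1 1≤i i≤n ℕ.≤-refl 1≤n)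
             (colPartLo (suc i) 2 (s≤s z≤n) 1+i≤n (s≤s z≤n) 2≤n)
             (C₁≡1⇒1≤C₂ 1≤i i≤n∸2))
    where
    i≤n∸2 = ℕ.≤-trans i≤n∸3 (ℕ.∸-monoʳ-≤ n (ℕ.n≤1+n 2))
    3+i≤n = m≤n∸k⇒k+m≤n n 3 1≤i i≤n∸3
    2≤n   = ℕ.≤-trans (s≤s (s≤s z≤n)) 3+i≤n
    1+i≤n = ℕ.≤-trans (ℕ.n≤1+n (suc i)) (ℕ.<⇒≤ 3+i≤n)
    i≤n   = ℕ.<⇒≤ 1+i≤n
    1≤n   = ℕ.≤-trans 1≤i i≤n

  a₁-nonneg : ∀ {k} → 1 ℕ.≤ k → k ℕ.≤ n → 0ℤ ≤ a 1 k
  a₁-nonneg {k} 1≤k k≤n =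
    subst (0ℤ ≤_) (Σℤ-single (λ i′ → a i′ k)) (colPartLo 1 k ℕ.≤-refl (ℕ.≤-trans 1≤k k≤n) 1≤k k≤n)

  R₁≤1 : ∀ {k} → k ℕ.≤ n → R 1 k ≤ + 1
  R₁≤1 {zero}  _     = +≤+ z≤n
  R₁≤1 {suc k} 1+k≤n = begin
    R 1 (suc k)                                  ≤⟨ ℤ.i≤i+j _ _ {{nonNegative tail-nonneg}} ⟩
    R 1 (suc k) + Σℤ (suc (suc k)) n (a 1)       ≡⟨ Σℤ-split (a 1) 1+k≤n ⟨
    R 1 n                                        ≡⟨ rowSum 1 ℕ.≤-refl (ℕ.≤-trans (s≤s z≤n) 1+k≤n) ⟩
    + 1                                          ∎
    where
    tail-nonneg : 0ℤ ≤ Σℤ (suc (suc k)) n (a 1)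
    tail-nonneg = subst (_≤ Σℤ (suc (suc k)) n (a 1)) (Σℤ-zeros (suc (suc k)) n)
      (Σℤ-mono (suc (suc k)) n (λ t 2+k≤t t≤n → a₁-nonneg (ℕ.≤-trans (s≤s z≤n) 2+k≤t) t≤n))

  R₁≡1⇒C₁≤0 : ∀ {k} → suc k ℕ.≤ n → R 1 k ≡ + 1 → C 1 (suc k) ≤ 0ℤ
  R₁≡1⇒C₁≤0 {k} 1+k≤n R≡1 = subst (_≤ 0ℤ) (sym (Σℤ-single (λ i′ → a i′ (suc k))))
    (x+y≤x⇒y≤0 (R 1 k) (begin
      R 1 k + a 1 (suc k)  ≡⟨ R-snoc 1 k ⟨
      R 1 (suc k)          ≤⟨ R₁≤1 1+k≤n ⟩
      + 1                  ≡⟨ R≡1 ⟨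
      R 1 k                ∎))

  R₂-absorbs-C₂ : ∀ {k} → C 1 (suc k) ≤ 0ℤ → R 2 k + C 2 (suc k) ≤ R 2 (suc k)
  R₂-absorbs-C₂ {k} C₁≤0 = begin
    R 2 k + C 2 (suc k)                  ≡⟨ cong (_+_ (R 2 k)) (C-snoc 1 (suc k)) ⟩
    R 2 k + (C 1 (suc k) + a 2 (suc k))  ≤⟨ ℤ.+-monoʳ-≤ (R 2 k) (ℤ.+-monoˡ-≤ (a 2 (suc k)) C₁≤0) ⟩
    R 2 k + (0ℤ + a 2 (suc k))           ≡⟨ cong (_+_ (R 2 k)) (ℤ.+-identityˡ (a 2 (suc k))) ⟩
    R 2 k + a 2 (suc k)                  ≡⟨ R-snoc 2 k ⟨
    R 2 (suc k)                          ∎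

  R₁≡0⇒C₁≡R₁ : ∀ {k} → R 1 k ≡ 0ℤ → C 1 (suc k) ≡ R 1 (suc k)
  R₁≡0⇒C₁≡R₁ {k} R₁≡0 = begin-equality
    C 1 (suc k)            ≡⟨ Σℤ-single (λ i′ → a i′ (suc k)) ⟩
    a 1 (suc k)            ≡⟨ ℤ.+-identityˡ (a 1 (suc k)) ⟨
    0ℤ + a 1 (suc k)       ≡⟨ cong (_+ a 1 (suc k)) R₁≡0 ⟨
    R 1 k + a 1 (suc k)    ≡⟨ R-snoc 1 k ⟨
    R 1 (suc k)            ∎

  R₁≡1⇒1≤R₂ : ∀ k → k ℕ.≤ n ∸ 2 → R 1 k ≡ + 1 → + 1 ≤ R 2 (suc k)
  R₁≡1⇒1≤R₂ zero    _        ()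
  R₁≡1⇒1≤R₂ (suc k) 1+k≤n∸2 R₁≡1 =
    by-R₁k (0≤x≤1⇒x≡0∨x≡1 (R-nonneg k ℕ.≤-refl 1≤n k≤n) (R₁≤1 k≤n))
    where
    1≤n∸2 = ℕ.≤-trans (s≤s z≤n) 1+k≤n∸2
    2+k≤n = ℕ.<⇒≤ (m≤n∸k⇒k+m≤n n 2 (s≤s z≤n) 1+k≤n∸2)
    2≤n   = ℕ.≤-trans (s≤s (s≤s z≤n)) 2+k≤n
    1≤n   = ℕ.≤-trans (s≤s z≤n) 2≤n
    k≤n   = ℕ.≤-trans (ℕ.n≤1+n k) (ℕ.<⇒≤ 2+k≤n)

    C₁≤0 : C 1 (2 ℕ.+ k) ≤ 0ℤ
    C₁≤0 = R₁≡1⇒C₁≤0 2+k≤n R₁≡1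

    by-R₁k : R 1 k ≡ 0ℤ ⊎ R 1 k ≡ + 1 → + 1 ≤ R 2 (2 ℕ.+ k)
    by-R₁k (inj₂ R₁≡1′) = begin
      + 1                              ≤⟨ R₁≡1⇒1≤R₂ k (ℕ.<⇒≤ 1+k≤n∸2) R₁≡1′ ⟩
      R 2 (suc k)                      ≤⟨ ℤ.i≤i+j _ _ {{nonNegative C₂-nonneg}} ⟩
      R 2 (suc k) + C 2 (2 ℕ.+ k)      ≤⟨ R₂-absorbs-C₂ C₁≤0 ⟩
      R 2 (2 ℕ.+ k)                    ∎
      where
      C₂-nonneg : 0ℤ ≤ C 2 (2 ℕ.+ k)
      C₂-nonneg = colPartLo 2 (2 ℕ.+ k) (s≤s z≤n) 2≤n (s≤s z≤n) 2+k≤n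
    by-R₁k (inj₁ R₁≡0) = begin
      + 1                              ≡⟨ R₁≡1 ⟨
      R 1 (suc k)                      ≡⟨ R₁≡0⇒C₁≡R₁ R₁≡0 ⟨
      C 1 (suc k)                      ≤⟨ extra-≤ ℕ.≤-refl 1≤n∸2 (s≤s z≤n) 1+k≤n∸2 ⟩
      R 2 (suc k) + C 2 (2 ℕ.+ k)      ≤⟨ R₂-absorbs-C₂ C₁≤0 ⟩
      R 2 (2 ℕ.+ k)                    ∎

  R₁≤R₂ : ∀ {k} → 1 ℕ.≤ k → k ℕ.≤ n ∸ 2 → R 1 k ≤ R 2 (suc k)
  R₁≤R₂ {k} 1≤k k≤n∸2 =
    bit-≤ (R-nonneg k ℕ.≤-refl 1≤n k≤n) (R₁≤1 k≤n)
          (R-nonneg (suc k) (s≤s z≤n) 2≤n 1+k≤n) (R₁≡1⇒1≤R₂ k k≤n∸2)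
    where
    2+k≤n = m≤n∸k⇒k+m≤n n 2 1≤k k≤n∸2
    1+k≤n = ℕ.<⇒≤ 2+k≤n
    k≤n   = ℕ.<⇒≤ 1+k≤n
    2≤n   = ℕ.≤-trans (s≤s (s≤s z≤n)) 2+k≤n
    1≤n   = ℕ.≤-trans 1≤k k≤n

  row-inequality : ∀ j → 1 ℕ.≤ j → j ℕ.≤ n ∸ 3 → + 1 ≤ R 2 (suc j) + Σℤ (suc j) n (a 1)
  row-inequality j 1≤j j≤n∸3 =
    p+t≡1⇒p≤q⇒1≤q+t (trans (sym (Σℤ-split (a 1) j≤n)) (rowSum 1 ℕ.≤-refl 1≤n)) (R₁≤R₂ 1≤j j≤n∸2)
    where
    j≤n∸2 = ℕ.≤-trans j≤n∸3 (ℕ.∸-monoʳ-≤ n (ℕ.n≤1+n 2))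
    j≤n   = ℕ.≤-trans j≤n∸2 (ℕ.m∸n≤m n 2)
    1≤n   = ℕ.≤-trans 1≤j j≤n

  module Crossing {i : ℕ} (1≤i : 1 ℕ.≤ i) (i≤n∸2 : i ℕ.≤ n ∸ 2) where

    S : ℕ → ℤ
    S k = R (suc i) k + C (suc i) (suc k)

    1+i≤n : suc i ℕ.≤ n
    1+i≤n = ℕ.<⇒≤ (m≤n∸k⇒k+m≤n n 2 1≤i i≤n∸2)

    C≤S : ∀ {k} → k ℕ.≤ n → C (suc i) (suc k) ≤ S k
    C≤S {k} k≤n = ℤ.i≤j+i _ _ {{nonNegative (R-nonneg k (s≤s z≤n) 1+i≤n k≤n)}}

    S-step : ∀ {k} → suc k ℕ.≤ n ∸ 2 → S (suc k) ≤ 0ℤ → S k ≤ 0ℤ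
    S-step {k} 1+k≤n∸2 S≤0 = begin
      R (suc i) k + C (suc i) (suc k)                  ≡⟨ cong (_+_ (R (suc i) k)) (C-snoc i (suc k)) ⟩
      R (suc i) k + (C i (suc k) + a (suc i) (suc k))  ≡⟨ x∙yz≈xz∙y (R (suc i) k) (C i (suc k)) (a (suc i) (suc k)) ⟩
      R (suc i) k + a (suc i) (suc k) + C i (suc k)    ≡⟨ cong (_+ C i (suc k)) (R-snoc (suc i) k) ⟨
      R (suc i) (suc k) + C i (suc k)                  ≤⟨ ℤ.+-mono-≤ R≤S Cᵢ≤S ⟩
      S (suc k) + S (suc k)                            ≤⟨ ℤ.+-mono-≤ S≤0 S≤0 ⟩
      0ℤ                                               ∎
      where
      2+k≤n = ℕ.<⇒≤ (m≤n∸k⇒k+m≤n n 2 (s≤s z≤n) 1+k≤n∸2)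
      R≤S : R (suc i) (suc k) ≤ S (suc k)
      R≤S = ℤ.i≤i+j _ _ {{nonNegative (colPartLo (suc i) (2 ℕ.+ k) (s≤s z≤n) 1+i≤n (s≤s z≤n) 2+k≤n)}}
      Cᵢ≤S : C i (suc k) ≤ S (suc k)
      Cᵢ≤S = extra-≤ 1≤i i≤n∸2 (s≤s z≤n) 1+k≤n∸2

    S-nonpos-below : ∀ {j k} → j ℕ.≤ n ∸ 2 → k ℕ.≤ j → S j ≤ 0ℤ → S k ≤ 0ℤ
    S-nonpos-below {zero}  _       z≤n  S≤0 = S≤0
    S-nonpos-below {suc j} 1+j≤n∸2 k≤1+j S≤0 with ℕ.m≤n⇒m<n∨m≡n k≤1+j
    ... | inj₂ refl      = S≤0
    ... | inj₁ (s≤s k≤j) = S-nonpos-below (ℕ.<⇒≤ 1+j≤n∸2) k≤j (S-step 1+j≤n∸2 S≤0)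

    S-nonpos⇒few-rows : ∀ {j} → suc j ℕ.≤ n → j ℕ.≤ n ∸ 2 → S j ≤ 0ℤ → suc i ℕ.≤ n ∸ suc j
    S-nonpos⇒few-rows {j} 1+j≤n j≤n∸2 S≤0 = ℤ.drop‿+≤+ (begin
      + suc i                                                    ≡⟨ rows-total 1+i≤n ⟨
      Σℤ 1 n (C (suc i))                                         ≡⟨ Σℤ-split (C (suc i)) 1+j≤n ⟩
      Σℤ 1 (suc j) (C (suc i)) + Σℤ (suc (suc j)) n (C (suc i))  ≤⟨ ℤ.+-mono-≤ left-nonpos right-bound ⟩
      + (n ∸ suc j)                                              ∎)
      where
      left-nonpos : Σℤ 1 (suc j) (C (suc i)) ≤ 0ℤ
      left-nonpos = subst (Σℤ 1 (suc j) (C (suc i)) ≤_) (Σℤ-zeros 1 (suc j))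
        (Σℤ-mono 1 (suc j) {C (suc i)} {λ _ → 0ℤ} λ
          { zero    ()       _
          ; (suc k) _ 1+k≤1+j → let k≤j = ℕ.s≤s⁻¹ 1+k≤1+j in
              ℤ.≤-trans (C≤S (ℕ.≤-trans k≤j (ℕ.<⇒≤ 1+j≤n))) (S-nonpos-below j≤n∸2 k≤j S≤0) })
      right-bound : Σℤ (suc (suc j)) n (C (suc i)) ≤ + (n ∸ suc j)
      right-bound = subst (Σℤ (suc (suc j)) n (C (suc i)) ≤_) (Σℤ-ones (suc (suc j)) n)
        (Σℤ-mono (suc (suc j)) n {C (suc i)} (λ t 2+j≤t t≤n →
          colPartHi (suc i) t (s≤s z≤n) 1+i≤n (ℕ.≤-trans (s≤s z≤n) 2+j≤t) t≤n))

    crossing-inequality : ∀ {j} → 1 ℕ.≤ j → j ℕ.≤ n ∸ 2 → n ∸ 1 ℕ.≤ i ℕ.+ j → + 1 ≤ S j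
    crossing-inequality {j} 1≤j j≤n∸2 n∸1≤i+j with + 1 ℤ.≤? S j
    ... | yes 1≤S = 1≤S
    ... | no  1≰S = contradiction n∸1≤i+j (ℕ.<⇒≱ i+j<n∸1)
      where
      1+j≤n = ℕ.<⇒≤ (m≤n∸k⇒k+m≤n n 2 1≤j j≤n∸2)
      rows+cols≤n : suc i ℕ.+ suc j ℕ.≤ n
      rows+cols≤n = ℕ.m≤o∸n⇒m+n≤o (suc i) 1+j≤n
        (S-nonpos⇒few-rows 1+j≤n j≤n∸2 (ℤ.i<j⇒i≤pred[j] (ℤ.≰⇒> 1≰S)))
      i+j<n∸1 : i ℕ.+ j ℕ.< n ∸ 1
      i+j<n∸1 = subst (ℕ._≤ n ∸ 1) (ℕ.+-suc i j) (ℕ.∸-monoˡ-≤ 1 rows+cols≤n)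

module Convexity where
  open import Data.Nat using (ℕ; zero; suc; _<?_)
  open import Data.Integer.Base as ℤ using (ℤ; +_; 0ℤ)
  import Data.Integer.Properties as ℤ
  open import Data.Nat.Coprimality using (1-coprimeTo) renaming (sym to coprime-sym)
  open import Data.Rational.Base using (ℚ; 0ℚ; 1ℚ; mkℚ; _+_; _*_; _≤_; _/_; *≤*; nonNegative)
  import Data.Rational.Properties as ℚ
  open import Data.List.Base using (List; []; _∷_; foldr)
  open import Data.List.Properties using (foldr-cong; foldr-fusion)
  open import Data.Product.Base using (_×_; _,_)
  open import Relation.Binary.PropositionalEquality
  open import Relation.Nullary using (yes; no)
  open import Algebra.Bundles using (CommutativeMonoid)
  open import Algebra.Properties.CommutativeSemigroup
    (CommutativeMonoid.commutativeSemigroup ℚ.+-0-commutativeMonoid) using (interchange)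

  data Line : Set where
    row col : ℕ → Line

  along : ∀ {A : Set} → Line → (ℕ → ℕ → A) → ℕ → A
  along (row i) a k = a i k
  along (col j) a k = a k j

  toℚ≡mkℚ : ∀ z → toℚ z ≡ mkℚ z 0 (coprime-sym (1-coprimeTo _))
  toℚ≡mkℚ z = ℚ.↥p/↧p≡p (mkℚ z 0 (coprime-sym (1-coprimeTo _)))

  toℚ-+ : ∀ x y → toℚ (x ℤ.+ y) ≡ toℚ x + toℚ y
  toℚ-+ x y = sym (begin
    toℚ x + toℚ y                      ≡⟨ cong₂ _+_ (toℚ≡mkℚ x) (toℚ≡mkℚ y) ⟩
    (x ℤ.* + 1 ℤ.+ y ℤ.* + 1) / 1      ≡⟨ cong₂ (λ u v → (u ℤ.+ v) / 1) (ℤ.*-identityʳ x) (ℤ.*-identityʳ y) ⟩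
    toℚ (x ℤ.+ y)                      ∎)
    where open ≡-Reasoning

  1≤toℚ : ∀ {z} → + 1 ℤ.≤ z → 1ℚ ≤ toℚ z
  1≤toℚ {z} 1≤z = subst (1ℚ ≤_) (sym (toℚ≡mkℚ z)) (*≤* (subst (+ 1 ℤ.≤_) (sym (ℤ.*-identityʳ z)) 1≤z))

  Σℚ-cong : ∀ a b {f g : ℕ → ℚ} → (∀ k → f k ≡ g k) → Σℚ a b f ≡ Σℚ a b g
  Σℚ-cong a b f≡g = foldr-cong (λ k s → cong (_+ s) (f≡g k)) refl (range a b)

  Σℚ-toℚ : ∀ a b f → Σℚ a b (λ k → toℚ (f k)) ≡ toℚ (Σℤ a b f)
  Σℚ-toℚ a b f = sym (foldr-fusion toℚ 0ℤ (λ k s → toℚ-+ (f k) s) (range a b))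

  weighted : ∀ {n} → List (ℚ × Mat n ℤ) → (Mat n ℤ → ℚ) → ℚ
  weighted []             g = 0ℚ
  weighted ((l , M) ∷ ps) g = l * g M + weighted ps g

  weighted-zero : ∀ {n} (ps : List (ℚ × Mat n ℤ)) → weighted ps (λ _ → 0ℚ) ≡ 0ℚ
  weighted-zero []             = refl
  weighted-zero ((l , _) ∷ ps) = cong₂ _+_ (ℚ.*-zeroʳ l) (weighted-zero ps)

  weighted-+ : ∀ {n} (ps : List (ℚ × Mat n ℤ)) g h →
               weighted ps (λ M → g M + h M) ≡ weighted ps g + weighted ps h
  weighted-+ []             g h = refl
  weighted-+ ((l , M) ∷ ps) g h = begin
    l * (g M + h M) + weighted ps (λ M → g M + h M)        ≡⟨ cong₂ _+_ (ℚ.*-distribˡ-+ l (g M) (h M)) (weighted-+ ps g h) ⟩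
    (l * g M + l * h M) + (weighted ps g + weighted ps h)  ≡⟨ interchange (l * g M) (l * h M) (weighted ps g) (weighted ps h) ⟩
    (l * g M + weighted ps g) + (l * h M + weighted ps h)  ∎
    where open ≡-Reasoning

  combine≡weighted : ∀ {n} (ps : List (ℚ × Mat n ℤ)) i j → combine ps i j ≡ weighted ps (λ M → toℚ (M i j))
  combine≡weighted []             i j = refl
  combine≡weighted ((l , M) ∷ ps) i j = cong (_+_ (l * toℚ (M i j))) (combine≡weighted ps i j)

  entry≡weighted : ∀ {n} {A : Mat n ℚ} (ps : List (ℚ × Mat n ℤ)) → (∀ i j → A i j ≡ combine ps i j) →
                   ∀ x y → entry 0ℚ A x y ≡ weighted ps (λ M → toℚ (entry 0ℤ M x y))
  entry≡weighted ps A≡ zero    y       = sym (weighted-zero ps)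
  entry≡weighted ps A≡ (suc x) zero    = sym (weighted-zero ps)
  entry≡weighted {n} ps A≡ (suc x) (suc y) with x <? n | y <? n
  ... | yes _ | yes _ = trans (A≡ _ _) (combine≡weighted ps _ _)
  ... | yes _ | no  _ = sym (weighted-zero ps)
  ... | no  _ | _     = sym (weighted-zero ps)

  Σℚ-weighted : ∀ {n} a b (ps : List (ℚ × Mat n ℤ)) (G : ℕ → Mat n ℤ → ℚ) →
                Σℚ a b (λ k → weighted ps (G k)) ≡ weighted ps (λ M → Σℚ a b (λ k → G k M))
  Σℚ-weighted a b ps G = foldr-weighted (range a b)
    where
    foldr-weighted : ∀ xs → foldr (λ k s → weighted ps (G k) + s) 0ℚ xs
                            ≡ weighted ps (λ M → foldr (λ k s → G k M + s) 0ℚ xs)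
    foldr-weighted []       = sym (weighted-zero ps)
    foldr-weighted (x ∷ xs) =
      trans (cong (_+_ (weighted ps (G x))) (foldr-weighted xs)) (sym (weighted-+ ps (G x) _))

  sumWeights≤weighted : ∀ {n} {ps : List (ℚ × Mat n ℤ)} → AllMagogPos n ps → (g : Mat n ℤ → ℚ) →
                        (∀ M → IsMagog n M → 1ℚ ≤ g M) → sumWeights ps ≤ weighted ps g
  sumWeights≤weighted []                                g 1≤g = ℚ.≤-refl
  sumWeights≤weighted (_∷_ {l} {M} (0≤l , magog) rest) g 1≤g =
    ℚ.+-mono-≤ l≤l*g (sumWeights≤weighted rest g 1≤g)
    where
    instance _ = nonNegative 0≤l
    l≤l*g : l ≤ l * g M
    l≤l*g = begin
      l       ≡⟨ ℚ.*-identityʳ l ⟨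
      l * 1ℚ  ≤⟨ ℚ.*-monoˡ-≤-nonNeg l (1≤g M magog) ⟩
      l * g M ∎
      where open ℚ.≤-Reasoning

  convex-bound : ∀ {n A} → InTSSCPP n A → ∀ L₁ a₁ b₁ L₂ a₂ b₂ →
    (∀ M → IsMagog n M →
       + 1 ℤ.≤ Σℤ a₁ b₁ (along L₁ (entry 0ℤ M)) ℤ.+ Σℤ a₂ b₂ (along L₂ (entry 0ℤ M))) →
    1ℚ ≤ Σℚ a₁ b₁ (along L₁ (entry 0ℚ A)) + Σℚ a₂ b₂ (along L₂ (entry 0ℚ A))
  convex-bound {n} {A} (ps , magogs , Σw≡1 , A≡) L₁ a₁ b₁ L₂ a₂ b₂ magog-bound = begin
    1ℚ                                                     ≡⟨ Σw≡1 ⟨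
    sumWeights ps                                          ≤⟨ sumWeights≤weighted magogs _ 1≤segments ⟩
    weighted ps (λ M → segment L₁ a₁ b₁ M + segment L₂ a₂ b₂ M)
                                                           ≡⟨ weighted-+ ps _ _ ⟩
    weighted ps (segment L₁ a₁ b₁) + weighted ps (segment L₂ a₂ b₂)
                                                           ≡⟨ cong₂ _+_ (Σℚ-along L₁ a₁ b₁) (Σℚ-along L₂ a₂ b₂) ⟨
    Σℚ a₁ b₁ (along L₁ (entry 0ℚ A)) + Σℚ a₂ b₂ (along L₂ (entry 0ℚ A))
                                                           ∎
    where
    open ℚ.≤-Reasoning

    segment : Line → ℕ → ℕ → Mat n ℤ → ℚ
    segment L a b M = Σℚ a b (λ k → toℚ (along L (entry 0ℤ M) k))

    along≡weighted : ∀ L k → along L (entry 0ℚ A) k ≡ weighted ps (λ M → toℚ (along L (entry 0ℤ M) k))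
    along≡weighted (row i) k = entry≡weighted ps A≡ i k
    along≡weighted (col j) k = entry≡weighted ps A≡ k j

    Σℚ-along : ∀ L a b → Σℚ a b (along L (entry 0ℚ A)) ≡ weighted ps (segment L a b)
    Σℚ-along L a b = trans (Σℚ-cong a b (along≡weighted L)) (Σℚ-weighted a b ps _)

    1≤segments : ∀ M → IsMagog n M → 1ℚ ≤ segment L₁ a₁ b₁ M + segment L₂ a₂ b₂ M
    1≤segments M magog = subst (1ℚ ≤_)
      (trans (toℚ-+ (Σℤ a₁ b₁ f₁) (Σℤ a₂ b₂ f₂)) (sym (cong₂ _+_ (Σℚ-toℚ a₁ b₁ f₁) (Σℚ-toℚ a₂ b₂ f₂))))
      (1≤toℚ (magog-bound M magog))
      where
      f₁ = along L₁ (entry 0ℤ M)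
      f₂ = along L₂ (entry 0ℤ M)

open import Data.Nat using (suc; _≤_; _∸_; _+_)
open import Data.Rational using (ℚ; 0ℚ; 1ℚ) renaming (_≤_ to _≤ℚ_; _+_ to _+ℚ_)
open import Data.Product using (_×_; _,_)
open Convexity using (convex-bound; row; col)
open MagogInequalities using (module Crossing; row-inequality; column-inequality)

theorem4p5 : (n : ℕ) → 1 ≤ n → (A : Mat n ℚ) → InTSSCPP n A →
    let a = entry 0ℚ A in
    ((i j : ℕ) → 1 ≤ i → i ≤ n ∸ 2 → 1 ≤ j → j ≤ n ∸ 2 → n ∸ 1 ≤ i + j →
      1ℚ ≤ℚ (Σℚ 1 j (λ j' → a (suc i) j') +ℚ Σℚ 1 (suc i) (λ i' → a i' (suc j))))
    × ((j : ℕ) → 1 ≤ j → j ≤ n ∸ 3 →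
      1ℚ ≤ℚ (Σℚ 1 (suc j) (λ j' → a 2 j') +ℚ Σℚ (suc j) n (λ j' → a 1 j')))
    × ((i : ℕ) → 1 ≤ i → i ≤ n ∸ 3 →
      1ℚ ≤ℚ (Σℚ 1 (suc i) (λ i' → a i' 2) +ℚ Σℚ (suc i) n (λ i' → a i' 1)))
theorem4p5 n _ A A∈TSSCPP =
    (λ i j 1≤i i≤n∸2 1≤j j≤n∸2 n∸1≤i+j →
       convex-bound A∈TSSCPP (row (suc i)) 1 j (col (suc j)) 1 (suc i)
         (λ M magog → Crossing.crossing-inequality magog 1≤i i≤n∸2 1≤j j≤n∸2 n∸1≤i+j))
  , (λ j 1≤j j≤n∸3 →
       convex-bound A∈TSSCPP (row 2) 1 (suc j) (row 1) (suc j) n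
         (λ M magog → row-inequality magog j 1≤j j≤n∸3))
  , (λ i 1≤i i≤n∸3 →
       convex-bound A∈TSSCPP (col 2) 1 (suc i) (col 1) (suc i) n
         (λ M magog → column-inequality magog i 1≤i i≤n∸3))
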